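{- Suppose that $B:\mathbb{Z}_{\ge0}^2\to\mathbb{Z}$ has the double Lucas property and satisfies $B(n,k)=B(n,n-k)$ for all $0\le k\le n$. Then the sequence $$A(n)=\sum_{k=0}^n(-1)^kB(n,k)\binom{2n-3k}{n}$$ satisfies the Lucas congruences: for every prime $p$ and every $n\ge0$ with base-$p$ expansion $n=n_0+n_1p+\cdots+n_rp^r$, $A(n)\equiv A(n_0)A(n_1)\cdots A(n_r)\pmod p$.
   Context: For integers $m\ge0$ and any number $x$, $\binom{x}{m}=\frac{x(x-1)\cdots(x-m+1)}{m!}$ (so the upper entry $2n-3k$ may be negative). A function $B:\mathbb{Z}_{\ge0}^2\to\mathbb{Z}$ has the double Lucas property if $B(n,k)=0$ whenever $k>n$, and for every prime $p$ and all $n,k\ge0$, writing $n=\sum_{i=0}^r n_ip^i$, $k=\sum_{i=0}^r k_ip^i$ with base-$p$ digits $0\le n_i,k_i<p$ (padded with zeros to a common length), $B(n,k)\equiv\prod_{i=0}^r B(n_i,k_i)\pmod p$. -}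

module Defs where

open import Data.Nat as ℕ using (ℕ; zero; suc; _<?_; _!; NonZero)
open import Data.Nat.Properties using (_!≢0)
import Data.Nat.DivMod as ℕD
open import Data.Integer as ℤ using (ℤ; +_; -_; _-_; _*_; _+_)
open import Data.Integer.DivMod using (_/ℕ_)
open import Relation.Nullary using (yes; no)

falling : ℤ → ℕ → ℤ
falling x zero    = + 1
falling x (suc m) = falling x m * (x - + m)

-- generalized binomial coefficient  binom x m = x(x-1)...(x-m+1)/m!
-- (the division is exact; _/ℕ_ is integer division by a nonzero natural)
binom : ℤ → ℕ → ℤ
binom x m = (falling x m /ℕ (m !)) {{m !≢0}}

sgn : ℕ → ℤ
sgn zero    = + 1
sgn (suc k) = - sgn k

sumTo : ℕ → (ℕ → ℤ) → ℤ
sumTo zero    f = f 0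
sumTo (suc n) f = sumTo n f + f (suc n)

Aseq : (ℕ → ℕ → ℤ) → ℕ → ℤ
Aseq B n = sumTo n (λ k → sgn k * B n k * binom (+ (2 ℕ.* n) - + (3 ℕ.* k)) n)

-- Product over base-p digits (minimal common length r+1, where r is the
-- largest index with a nonzero digit in n or k, and r = 0 for n = k = 0):
--   digitProd₂ p B n k = Π_{i=0}^r B(n_i, k_i).
-- Implemented by recursion with fuel; fuel ≥ n + k suffices for p ≥ 2.
digitProd₂-fuel : ℕ → (p : ℕ) → .{{NonZero p}} → (ℕ → ℕ → ℤ) → ℕ → ℕ → ℤ
digitProd₂-fuel zero    p B n k = B n k
digitProd₂-fuel (suc f) p B n k with n <? p | k <? p
... | yes _ | yes _ = B n k
... | _     | _     = B (n ℕD.% p) (k ℕD.% p) * digitProd₂-fuel f p B (n ℕD./ p) (k ℕD./ p)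

-- (p = 0 never occurs in use since p is prime; the clause only makes the function total)
digitProd₂ : ℕ → (ℕ → ℕ → ℤ) → ℕ → ℕ → ℤ
digitProd₂ zero    B n k = B n k
digitProd₂ (suc q) B n k = digitProd₂-fuel (n ℕ.+ k) (suc q) B n k

-- Product over base-p digits of n = n_0 + ... + n_r p^r (r minimal, r = 0 for n = 0):
--   digitProd p A n = A(n_0) A(n_1) ... A(n_r).
digitProd-fuel : ℕ → (p : ℕ) → .{{NonZero p}} → (ℕ → ℤ) → ℕ → ℤ
digitProd-fuel zero    p A n = A n
digitProd-fuel (suc f) p A n with n <? p
... | yes _ = A n
... | no  _ = A (n ℕD.% p) * digitProd-fuel f p A (n ℕD./ p)

digitProd : ℕ → (ℕ → ℤ) → ℕ → ℤ
digitProd zero    A n = A n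
digitProd (suc q) A n = digitProd-fuel n (suc q) A n

_≡[mod_]_ : ℤ → ℕ → ℤ → Set
x ≡[mod p ] y = (+ p) Data.Integer.Divisibility.∣ (x - y)
  where import Data.Integer.Divisibility

DoubleLucas : (ℕ → ℕ → ℤ) → Set
DoubleLucas B =
  (∀ n k → n ℕ.< k → B n k ≡ + 0) ×
  (∀ p → Prime p → ∀ n k →
     B n k ≡[mod p ] digitProd₂ p B n k)
  where
  open import Relation.Binary.PropositionalEquality using (_≡_)
  open import Data.Product using (_×_)
  open import Data.Nat.Primality using (Prime)

-- For a prime p, generalized binomial coefficients satisfy Lucas' theorem in the form
-- binom(x₀ + y p, n₀ + m p) ≡ binom(x₀, n₀) binom(y, m) (mod p) for digits x₀, n₀ and every
-- integer y: both sides obey Pascal's rule in (y, m), since (1 + t)^p ≡ 1 + t^p gives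
-- binom(x + p, k) ≡ binom(x, k) + binom(x, k - p).
-- Write n = n₀ + m p and k = k₀ + j p. Then 2n - 3k = s + (2m - 3j + c) p with a digit s and a
-- carry c depending only on (n₀, k₀); together with the double Lucas property and (-1)^p ≡ -1,
-- the (n, k) term of A(n) is congruent to the (n₀, k₀) term of A(n₀) times the j-th term of
-- A_c(m) = Σ_j (-1)^j B(m, j) binom(2m - 3j + c, m). For k₀ ≤ n₀ the carry is 0, -1 or 1.
-- A_0 = A; the reflection binom(x, m) = (-1)^m binom(m - 1 - x, m) and B(m, j) = B(m, m - j)
-- give A_{-1} = A; a carry 1 forces s < n₀, which kills the (n₀, k₀) factor.
-- Hence A(n₀ + m p) ≡ A(n₀) A(m), and induction on the number of digits finishes.

module Submission where

open import Defs
open import Data.Nat using (ℕ; _≤_; _∸_)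
open import Data.Nat.Primality using (Prime)
open import Data.Integer using (ℤ)
open import Relation.Binary.PropositionalEquality using (_≡_)

open import Data.Nat as ℕ using (zero; suc; _<_; _!; _%_; _/_; z≤n; s≤s)
import Data.Nat.Properties as ℕP
import Data.Nat.DivMod as ℕD
import Data.Nat.Divisibility as ℕ∣
open import Data.Nat.Induction using (<-rec)
open import Data.Nat.Primality using (euclidsLemma; prime⇒irreducible; prime⇒nonZero; ¬prime[0]; ¬prime[1])
open import Data.Integer as ℤ using (+_; -[1+_]; -_; _-_; _*_; _+_; ∣_∣; 0ℤ; 1ℤ; -1ℤ)
import Data.Integer.Properties as ℤP
open import Data.Integer.DivMod using (_/ℕ_; _%ℕ_; a≡a%ℕn+[a/ℕn]*n; n%ℕd<d)
open import Data.Integer.Divisibility.Signed using (_∣_; divides; ∣ᵤ⇒∣; ∣⇒∣ᵤ; 0∣⇒≡0)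
import Data.Integer.Divisibility.Signed as ℤ∣
open import Data.Integer.Tactic.RingSolver using (solve-∀; solve)
import Data.Nat.Tactic.RingSolver as ℕ-Solver
open import Data.List using (_∷_; [])
open import Data.Empty using (⊥-elim)
open import Data.Sum using (_⊎_; inj₁; inj₂)
open import Data.Product using (Σ; _×_; _,_; proj₁; proj₂)
open import Relation.Nullary using (yes; no; ¬_)
open import Relation.Binary.Bundles using (Setoid)
import Relation.Binary.Reasoning.Setoid
open import Relation.Binary.Definitions using (tri<; tri≈; tri>)
open import Relation.Binary.PropositionalEquality using (refl; sym; trans; cong; cong₂; subst; module ≡-Reasoning)

x+y-y≡x : ∀ x y → x + y - y ≡ x
x+y-y≡x = solve-∀

+[m∸n]≡+m-+n : ∀ {m n} → n ≤ m → + (m ∸ n) ≡ + m - + n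
+[m∸n]≡+m-+n {m} {n} n≤m = sym (trans (ℤP.[+m]-[+n]≡m⊖n m n) (ℤP.⊖-≥ n≤m))

ℤ-induction : (P : ℤ → Set) → P 0ℤ → (∀ x → P x → P (1ℤ + x)) → (∀ x → P (1ℤ + x) → P x) →
              ∀ x → P x
ℤ-induction P P0 up down (+ n)    = upward n
  where
  upward : ∀ n → P (+ n)
  upward zero    = P0
  upward (suc n) = up (+ n) (upward n)
ℤ-induction P P0 up down -[1+ n ] = downward n
  where
  downward : ∀ n → P -[1+ n ]
  downward zero    = down -1ℤ P0
  downward (suc n) = down -[1+ suc n ] (downward n)

sum< : ℕ → (ℕ → ℤ) → ℤ
sum< zero    f = 0ℤ
sum< (suc n) f = sum< n f + f n

sumTo≡sum< : ∀ n f → sumTo n f ≡ sum< (suc n) f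
sumTo≡sum< zero    f = sym (ℤP.+-identityˡ (f 0))
sumTo≡sum< (suc n) f = cong (_+ f (suc n)) (sumTo≡sum< n f)

sum<-cong : ∀ n {f g} → (∀ i → i < n → f i ≡ g i) → sum< n f ≡ sum< n g
sum<-cong zero    eq = refl
sum<-cong (suc n) eq = cong₂ _+_ (sum<-cong n (λ i i<n → eq i (ℕP.m<n⇒m<1+n i<n))) (eq n ℕP.≤-refl)

sum<-0 : ∀ n → sum< n (λ _ → 0ℤ) ≡ 0ℤ
sum<-0 zero    = refl
sum<-0 (suc n) = cong (_+ 0ℤ) (sum<-0 n)

sum<-+ : ∀ n f g → sum< n (λ i → f i + g i) ≡ sum< n f + sum< n g
sum<-+ zero    f g = refl
sum<-+ (suc n) f g = trans (cong (_+ (f n + g n)) (sum<-+ n f g))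
                           (interchange (sum< n f) (sum< n g) (f n) (g n))
  where interchange : ∀ a b c d → a + b + (c + d) ≡ a + c + (b + d)
        interchange = solve-∀

sum<-*ˡ : ∀ n c f → sum< n (λ i → c * f i) ≡ c * sum< n f
sum<-*ˡ zero    c f = sym (ℤP.*-zeroʳ c)
sum<-*ˡ (suc n) c f = trans (cong (_+ c * f n) (sum<-*ˡ n c f)) (sym (ℤP.*-distribˡ-+ c (sum< n f) (f n)))

sum<-*ʳ : ∀ n f c → sum< n (λ i → f i * c) ≡ sum< n f * c
sum<-*ʳ zero    f c = sym (ℤP.*-zeroˡ c)
sum<-*ʳ (suc n) f c = trans (cong (_+ f n * c) (sum<-*ʳ n f c)) (sym (ℤP.*-distribʳ-+ c (sum< n f) (f n)))

sum<-swap : ∀ a b (g : ℕ → ℕ → ℤ) →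
            sum< a (λ i → sum< b (g i)) ≡ sum< b (λ j → sum< a (λ i → g i j))
sum<-swap zero    b g = sym (sum<-0 b)
sum<-swap (suc a) b g = trans (cong (_+ sum< b (g a)) (sum<-swap a b g))
                              (sym (sum<-+ b (λ j → sum< a (λ i → g i j)) (g a)))

sum<-++ : ∀ m n f → sum< (m ℕ.+ n) f ≡ sum< m f + sum< n (λ i → f (m ℕ.+ i))
sum<-++ m zero    f = trans (cong (λ k → sum< k f) (ℕP.+-identityʳ m)) (sym (ℤP.+-identityʳ (sum< m f)))
sum<-++ m (suc n) f rewrite ℕP.+-suc m n | sum<-++ m n f = ℤP.+-assoc (sum< m f) _ _

sum<-blocks : ∀ a b f → sum< (b ℕ.* a) f ≡ sum< a (λ i → sum< b (λ j → f (i ℕ.+ j ℕ.* a)))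
sum<-blocks a b f = trans (by-rows b) (sym (sum<-swap a b (λ i j → f (i ℕ.+ j ℕ.* a))))
  where
  by-rows : ∀ b → sum< (b ℕ.* a) f ≡ sum< b (λ j → sum< a (λ i → f (i ℕ.+ j ℕ.* a)))
  by-rows zero    = refl
  by-rows (suc b) = begin
    sum< (a ℕ.+ b ℕ.* a) f
      ≡⟨ cong (λ k → sum< k f) (ℕP.+-comm a (b ℕ.* a)) ⟩
    sum< (b ℕ.* a ℕ.+ a) f
      ≡⟨ sum<-++ (b ℕ.* a) a f ⟩
    sum< (b ℕ.* a) f + sum< a (λ i → f (b ℕ.* a ℕ.+ i))
      ≡⟨ cong₂ _+_ (by-rows b) (sum<-cong a (λ i _ → cong f (ℕP.+-comm (b ℕ.* a) i))) ⟩
    sum< (suc b) (λ j → sum< a (λ i → f (i ℕ.+ j ℕ.* a)))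
      ∎
    where open ≡-Reasoning

sum<-pad : ∀ {n N} f → n ≤ N → (∀ k → n ≤ k → f k ≡ 0ℤ) → sum< N f ≡ sum< n f
sum<-pad {n} {N} f n≤N vanish = begin
  sum< N f                                     ≡⟨ cong (λ k → sum< k f) (ℕP.m+[n∸m]≡n n≤N) ⟨
  sum< (n ℕ.+ (N ∸ n)) f                       ≡⟨ sum<-++ n (N ∸ n) f ⟩
  sum< n f + sum< (N ∸ n) (λ i → f (n ℕ.+ i))  ≡⟨ cong (λ z → sum< n f + z) tail≡0 ⟩
  sum< n f + 0ℤ                                ≡⟨ ℤP.+-identityʳ (sum< n f) ⟩
  sum< n f                                     ∎
  where
  open ≡-Reasoning
  tail≡0 : sum< (N ∸ n) (λ i → f (n ℕ.+ i)) ≡ 0ℤ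
  tail≡0 = trans (sum<-cong (N ∸ n) (λ i _ → vanish (n ℕ.+ i) (ℕP.m≤m+n n i))) (sum<-0 (N ∸ n))

sum<-suc : ∀ n f → sum< (suc n) f ≡ f 0 + sum< n (λ i → f (suc i))
sum<-suc zero    f = trans (ℤP.+-identityˡ (f 0)) (sym (ℤP.+-identityʳ (f 0)))
sum<-suc (suc n) f = trans (cong (_+ f (suc n)) (sum<-suc n f)) (ℤP.+-assoc (f 0) _ _)

sum<-reverse : ∀ n f → sum< (suc n) f ≡ sum< (suc n) (λ j → f (n ∸ j))
sum<-reverse zero    f = refl
sum<-reverse (suc n) f = begin
  sum< (suc n) f + f (suc n)                  ≡⟨ cong (_+ f (suc n)) (sum<-reverse n f) ⟩
  sum< (suc n) (λ j → f (n ∸ j)) + f (suc n)  ≡⟨ ℤP.+-comm _ (f (suc n)) ⟩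
  f (suc n) + sum< (suc n) (λ j → f (n ∸ j))  ≡⟨ sum<-suc (suc n) (λ j → f (suc n ∸ j)) ⟨
  sum< (suc (suc n)) (λ j → f (suc n ∸ j))    ∎
  where open ≡-Reasoning

module Congruence (d : ℕ) where

  -- A record, so that x and y can be inferred from a proof of x ≈ y.
  infix 4 _≈_
  record _≈_ (x y : ℤ) : Set where
    constructor mk≈
    field divides-difference : + d ∣ x - y
  open _≈_ public

  private
    ∣-by : ∀ {a b} → + d ∣ a → a ≡ b → + d ∣ b
    ∣-by d∣a refl = d∣a

  ≡⇒≈ : ∀ {x y} → x ≡ y → x ≈ y
  ≡⇒≈ {x} refl = mk≈ (divides 0ℤ (trans (ℤP.+-inverseʳ x) (sym (ℤP.*-zeroˡ (+ d)))))

  ≈-refl : ∀ {x} → x ≈ x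
  ≈-refl = ≡⇒≈ refl

  ≈-sym : ∀ {x y} → x ≈ y → y ≈ x
  ≈-sym {x} {y} (mk≈ d∣x-y) = mk≈ (∣-by (ℤ∣.∣m⇒∣-m d∣x-y) (negate x y))
    where negate : ∀ x y → - (x - y) ≡ y - x
          negate = solve-∀

  ≈-trans : ∀ {x y z} → x ≈ y → y ≈ z → x ≈ z
  ≈-trans {x} {y} {z} (mk≈ d∣x-y) (mk≈ d∣y-z) =
    mk≈ (∣-by (ℤ∣.∣m∣n⇒∣m+n d∣x-y d∣y-z) (ℤP.+-minus-telescope x y z))

  ≈-setoid : Setoid _ _
  ≈-setoid = record
    { Carrier = ℤ ; _≈_ = _≈_
    ; isEquivalence = record { refl = ≈-refl ; sym = ≈-sym ; trans = ≈-trans } }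

  +-cong : ∀ {x y u v} → x ≈ y → u ≈ v → x + u ≈ y + v
  +-cong {x} {y} {u} {v} (mk≈ d∣x-y) (mk≈ d∣u-v) =
    mk≈ (∣-by (ℤ∣.∣m∣n⇒∣m+n d∣x-y d∣u-v) (regroup x y u v))
    where regroup : ∀ x y u v → (x - y) + (u - v) ≡ (x + u) - (y + v)
          regroup = solve-∀

  -‿cong : ∀ {x y} → x ≈ y → - x ≈ - y
  -‿cong {x} {y} (mk≈ d∣x-y) = mk≈ (∣-by (ℤ∣.∣m⇒∣-m d∣x-y) (negate x y))
    where negate : ∀ x y → - (x - y) ≡ - x - - y
          negate = solve-∀

  -‿cong₂ : ∀ {x y u v} → x ≈ y → u ≈ v → x - u ≈ y - v
  -‿cong₂ x≈y u≈v = +-cong x≈y (-‿cong u≈v)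

  *-cong : ∀ {x y u v} → x ≈ y → u ≈ v → x * u ≈ y * v
  *-cong {x} {y} {u} {v} (mk≈ d∣x-y) (mk≈ d∣u-v) =
    mk≈ (∣-by (ℤ∣.∣m∣n⇒∣m+n (ℤ∣.∣m⇒∣m*n u d∣x-y) (ℤ∣.∣n⇒∣m*n y d∣u-v))
              (regroup x y u v))
    where regroup : ∀ x y u v → (x - y) * u + y * (u - v) ≡ x * u - y * v
          regroup = solve-∀

  *-congˡ : ∀ c {u v} → u ≈ v → c * u ≈ c * v
  *-congˡ c u≈v = *-cong (≈-refl {c}) u≈v

  *-congʳ : ∀ c {u v} → u ≈ v → u * c ≈ v * c
  *-congʳ c u≈v = *-cong u≈v (≈-refl {c})

  sum<-cong≈ : ∀ n {f g} → (∀ i → i < n → f i ≈ g i) → sum< n f ≈ sum< n g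
  sum<-cong≈ zero    eq = ≈-refl
  sum<-cong≈ (suc n) eq = +-cong (sum<-cong≈ n (λ i i<n → eq i (ℕP.m<n⇒m<1+n i<n))) (eq n ℕP.≤-refl)

  x≈0⇒x*y≈x*z : ∀ {x y z} → x ≈ 0ℤ → x * y ≈ x * z
  x≈0⇒x*y≈x*z {x} {y} {z} x≈0 = ≈-trans (*-congʳ y x≈0)
    (≈-trans (≡⇒≈ (trans (ℤP.*-zeroˡ y) (sym (ℤP.*-zeroˡ z)))) (≈-sym (*-congʳ z x≈0)))

  ∣⇒≈0 : ∀ {x} → + d ∣ x → x ≈ 0ℤ
  ∣⇒≈0 {x} d∣x = mk≈ (∣-by d∣x (sym (ℤP.+-identityʳ x)))

  module ≈-Reasoning = Relation.Binary.Reasoning.Setoid ≈-setoid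

  invariant⇒constant : (f : ℤ → ℤ) → (∀ y → f (1ℤ + y) ≈ f y) → ∀ y → f y ≈ f 0ℤ
  invariant⇒constant f step = ℤ-induction (λ y → f y ≈ f 0ℤ) ≈-refl
    (λ y eq → ≈-trans (step y) eq) (λ y eq → ≈-trans (≈-sym (step y)) eq)

-- Falling factorials and generalized binomial coefficients

falling-suc : ∀ x m → falling (1ℤ + x) (suc m) ≡ (1ℤ + x) * falling x m
falling-suc x zero    = unit x
  where unit : ∀ x → 1ℤ * (1ℤ + x - 0ℤ) ≡ (1ℤ + x) * 1ℤ
        unit = solve-∀
falling-suc x (suc m) = begin
  falling (1ℤ + x) (suc m) * (1ℤ + x - + suc m) ≡⟨ cong (_* (1ℤ + x - + suc m)) (falling-suc x m) ⟩
  (1ℤ + x) * falling x m * (1ℤ + x - + suc m)   ≡⟨ reassoc x (falling x m) (+ m) ⟩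
  (1ℤ + x) * (falling x m * (x - + m))          ∎
  where
  open ≡-Reasoning
  reassoc : ∀ x f m → (1ℤ + x) * f * (1ℤ + x - (1ℤ + m)) ≡ (1ℤ + x) * (f * (x - m))
  reassoc = solve-∀

falling-pascal : ∀ x m → falling (1ℤ + x) (suc m) ≡ falling x (suc m) + + suc m * falling x m
falling-pascal x m = trans (falling-suc x m) (split x (falling x m) (+ m))
  where split : ∀ x f m → (1ℤ + x) * f ≡ f * (x - m) + (1ℤ + m) * f
        split = solve-∀

falling[0,1+m]≡0 : ∀ m → falling 0ℤ (suc m) ≡ 0ℤ
falling[0,1+m]≡0 m = trans (falling-suc -1ℤ m) (ℤP.*-zeroˡ (falling -1ℤ m))

falling[a,1+a+t]≡0 : ∀ a t → falling (+ a) (suc (a ℕ.+ t)) ≡ 0ℤ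
falling[a,1+a+t]≡0 a zero
  rewrite ℕP.+-identityʳ a | ℤP.+-inverseʳ (+ a) = ℤP.*-zeroʳ (falling (+ a) a)
falling[a,1+a+t]≡0 a (suc t)
  rewrite ℕP.+-suc a t | falling[a,1+a+t]≡0 a t = ℤP.*-zeroˡ (+ a - + suc (a ℕ.+ t))

falling[n,n]≡n! : ∀ n → falling (+ n) n ≡ + (n !)
falling[n,n]≡n! zero    = refl
falling[n,n]≡n! (suc n) = begin
  falling (+ suc n) (suc n) ≡⟨ falling-suc (+ n) n ⟩
  + suc n * falling (+ n) n ≡⟨ cong (+ suc n *_) (falling[n,n]≡n! n) ⟩
  + suc n * + (n !)         ≡⟨ ℤP.pos-* (suc n) (n !) ⟨
  + (suc n !)               ∎
  where open ≡-Reasoning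

m!∣y⇒[1+m]!∣[1+m]*y : ∀ m {y} → + (m !) ∣ y → + (suc m !) ∣ + suc m * y
m!∣y⇒[1+m]!∣[1+m]*y m {y} (divides q y≡q*m!) = divides q (begin
  + suc m * y                ≡⟨ cong (+ suc m *_) y≡q*m! ⟩
  + suc m * (q * + (m !))    ≡⟨ swap (+ suc m) q (+ (m !)) ⟩
  q * (+ suc m * + (m !))    ≡⟨ cong (q *_) (ℤP.pos-* (suc m) (m !)) ⟨
  q * + (suc m !)            ∎)
  where
  open ≡-Reasoning
  swap : ∀ a q b → a * (q * b) ≡ q * (a * b)
  swap = solve-∀

m!∣falling : ∀ x m → + (m !) ∣ falling x m
m!∣falling = ℤ-induction (λ x → ∀ m → + (m !) ∣ falling x m) at-0 up down
  where
  at-0 : ∀ m → + (m !) ∣ falling 0ℤ m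
  at-0 zero    = ℤ∣.∣-refl
  at-0 (suc m) = divides 0ℤ (falling[0,1+m]≡0 m)
  up : ∀ x → (∀ m → + (m !) ∣ falling x m) → ∀ m → + (m !) ∣ falling (1ℤ + x) m
  up x IH zero    = ℤ∣.∣-refl
  up x IH (suc m) rewrite falling-pascal x m = ℤ∣.∣m∣n⇒∣m+n (IH (suc m)) (m!∣y⇒[1+m]!∣[1+m]*y m (IH m))
  down : ∀ x → (∀ m → + (m !) ∣ falling (1ℤ + x) m) → ∀ m → + (m !) ∣ falling x m
  down x IH zero    = ℤ∣.∣-refl
  down x IH (suc m) = subst (+ (suc m !) ∣_) rearrange
    (ℤ∣.∣m∣n⇒∣m-n (IH (suc m)) (m!∣y⇒[1+m]!∣[1+m]*y m (down x IH m)))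
    where
    rearrange : falling (1ℤ + x) (suc m) - + suc m * falling x m ≡ falling x (suc m)
    rearrange = trans (cong (_- + suc m * falling x m) (falling-pascal x m)) (x+y-y≡x _ _)

[c*d]/ℕd≡c : ∀ c d .{{_ : ℕ.NonZero d}} → (c * + d) /ℕ d ≡ c
[c*d]/ℕd≡c c d = sym (ℤP.i-j≡0⇒i≡j c q (ℤP.∣i∣≡0⇒i≡0 ∣c-q∣≡0))
  where
  q : ℤ
  q = (c * + d) /ℕ d
  r : ℕ
  r = (c * + d) %ℕ d
  cancel : ∀ c q d r → c * d ≡ r + q * d → (c - q) * d ≡ r
  cancel c q d r eq = trans (factor c q d) (trans (cong (_- q * d) eq) (solve (r ∷ q ∷ d ∷ [])))
    where factor : ∀ c q d → (c - q) * d ≡ c * d - q * d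
          factor = solve-∀
  ∣c-q∣*d≡r : ∣ c - q ∣ ℕ.* d ≡ r
  ∣c-q∣*d≡r = trans (sym (ℤP.abs-* (c - q) (+ d)))
                   (cong ∣_∣ (cancel c q (+ d) (+ r) (a≡a%ℕn+[a/ℕn]*n (c * + d) d)))
  ∣c-q∣≡0 : ∣ c - q ∣ ≡ 0
  ∣c-q∣≡0 with ∣ c - q ∣ | ∣c-q∣*d≡r
  ... | zero  | _  = refl
  ... | suc e | eq = ⊥-elim (ℕP.<⇒≱ (n%ℕd<d (c * + d) d) (subst (d ℕ.≤_) eq (ℕP.m≤m+n d (e ℕ.* d))))

binom-unique : ∀ x m c → falling x m ≡ c * + (m !) → binom x m ≡ c
binom-unique x m c eq rewrite eq = [c*d]/ℕd≡c c (m !) {{m ℕP.!≢0}}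

falling≡binom*m! : ∀ x m → falling x m ≡ binom x m * + (m !)
falling≡binom*m! x m with m!∣falling x m
... | divides q eq rewrite binom-unique x m q eq = eq

binom[x,0]≡1 : ∀ x → binom x 0 ≡ 1ℤ
binom[x,0]≡1 x = binom-unique x 0 1ℤ refl

binom[n,n]≡1 : ∀ n → binom (+ n) n ≡ 1ℤ
binom[n,n]≡1 n = binom-unique (+ n) n 1ℤ (trans (falling[n,n]≡n! n) (sym (ℤP.*-identityˡ (+ (n !)))))

binom[a,k]≡0 : ∀ {a k} → a < k → binom (+ a) k ≡ 0ℤ
binom[a,k]≡0 {a} {k} a<k = binom-unique (+ a) k 0ℤ (begin
  falling (+ a) k                         ≡⟨ cong (falling (+ a)) (ℕP.m+[n∸m]≡n a<k) ⟨
  falling (+ a) (suc (a ℕ.+ (k ∸ suc a))) ≡⟨ falling[a,1+a+t]≡0 a (k ∸ suc a) ⟩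
  0ℤ                                      ≡⟨ ℤP.*-zeroˡ (+ (k !)) ⟨
  0ℤ * + (k !)                            ∎)
  where open ≡-Reasoning

binom-pascal : ∀ x m → binom (1ℤ + x) (suc m) ≡ binom x (suc m) + binom x m
binom-pascal x m = ℤP.*-cancelʳ-≡ _ _ (+ (suc m !)) {{suc m ℕP.!≢0}} (begin
  binom (1ℤ + x) (suc m) * + (suc m !)         ≡⟨ falling≡binom*m! (1ℤ + x) (suc m) ⟨
  falling (1ℤ + x) (suc m)                     ≡⟨ falling-pascal x m ⟩
  falling x (suc m) + + suc m * falling x m    ≡⟨ cong₂ (λ u v → u + + suc m * v)
                                                    (falling≡binom*m! x (suc m)) (falling≡binom*m! x m) ⟩
  b₁ * + (suc m !) + + suc m * (b₀ * + (m !))  ≡⟨ cong (λ z → b₁ * z + + suc m * (b₀ * + (m !)))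
                                                    (ℤP.pos-* (suc m) (m !)) ⟩
  b₁ * (+ suc m * + (m !)) + + suc m * (b₀ * + (m !)) ≡⟨ collect b₁ b₀ (+ suc m) (+ (m !)) ⟩
  (b₁ + b₀) * (+ suc m * + (m !))              ≡⟨ cong ((b₁ + b₀) *_) (ℤP.pos-* (suc m) (m !)) ⟨
  (b₁ + b₀) * + (suc m !)                      ∎)
  where
  open ≡-Reasoning
  b₁ b₀ : ℤ
  b₁ = binom x (suc m)
  b₀ = binom x m
  collect : ∀ b₁ b₀ s f → b₁ * (s * f) + s * (b₀ * f) ≡ (b₁ + b₀) * (s * f)
  collect = solve-∀

module PascalFamilies (d : ℕ) where
  open Congruence d
  open ≈-Reasoning

  Pascal : (ℤ → ℕ → ℤ) → Set
  Pascal F = ∀ x k → F (1ℤ + x) (suc k) ≈ F x (suc k) + F x k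

  pascal-unique : ∀ F G → Pascal F → Pascal G →
                  (∀ x → F x 0 ≈ G x 0) → (∀ k → F 0ℤ (suc k) ≈ G 0ℤ (suc k)) →
                  ∀ k x → F x k ≈ G x k
  pascal-unique F G pascal-F pascal-G column row zero    = column
  pascal-unique F G pascal-F pascal-G column row (suc k) =
    ℤ-induction (λ x → F x (suc k) ≈ G x (suc k)) (row k) up down
    where
    F≈G : ∀ x → F x k ≈ G x k
    F≈G = pascal-unique F G pascal-F pascal-G column row k
    up : ∀ x → F x (suc k) ≈ G x (suc k) → F (1ℤ + x) (suc k) ≈ G (1ℤ + x) (suc k)
    up x eq = begin
      F (1ℤ + x) (suc k)     ≈⟨ pascal-F x k ⟩
      F x (suc k) + F x k    ≈⟨ +-cong eq (F≈G x) ⟩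
      G x (suc k) + G x k    ≈⟨ pascal-G x k ⟨
      G (1ℤ + x) (suc k)     ∎
    down : ∀ x → F (1ℤ + x) (suc k) ≈ G (1ℤ + x) (suc k) → F x (suc k) ≈ G x (suc k)
    down x eq = begin
      F x (suc k)                    ≡⟨ x+y-y≡x (F x (suc k)) (F x k) ⟨
      F x (suc k) + F x k - F x k    ≈⟨ -‿cong₂ (pascal-F x k) ≈-refl ⟨
      F (1ℤ + x) (suc k) - F x k     ≈⟨ -‿cong₂ eq (F≈G x) ⟩
      G (1ℤ + x) (suc k) - G x k     ≈⟨ -‿cong₂ (pascal-G x k) ≈-refl ⟩
      G x (suc k) + G x k - G x k    ≡⟨ x+y-y≡x (G x (suc k)) (G x k) ⟩
      G x (suc k)                    ∎

  Pascal-+ : ∀ F G → Pascal F → Pascal G → Pascal (λ x k → F x k + G x k)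
  Pascal-+ F G pascal-F pascal-G x k = ≈-trans (+-cong (pascal-F x k) (pascal-G x k))
    (≡⇒≈ (interchange (F x (suc k)) (F x k) (G x (suc k)) (G x k)))
    where interchange : ∀ a b c d → a + b + (c + d) ≡ a + c + (b + d)
          interchange = solve-∀

  Pascal-*ˡ : ∀ c F → Pascal F → Pascal (λ x k → c * F x k)
  Pascal-*ˡ c F pascal-F x k =
    ≈-trans (*-congˡ c (pascal-F x k)) (≡⇒≈ (ℤP.*-distribˡ-+ c (F x (suc k)) (F x k)))

  Pascal-translate : ∀ c F → Pascal F → Pascal (λ x k → F (x + c) k)
  Pascal-translate c F pascal-F x k rewrite ℤP.+-assoc 1ℤ x c = pascal-F (x + c) k

  binom-isPascal : Pascal binom
  binom-isPascal x k = ≡⇒≈ (binom-pascal x k)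

reflectedBinom : ℤ → ℕ → ℤ
reflectedBinom x m = sgn m * binom (+ m - 1ℤ - x) m

reflectedBinom-pascal : ∀ x m →
  reflectedBinom (1ℤ + x) (suc m) ≡ reflectedBinom x (suc m) + reflectedBinom x m
reflectedBinom-pascal x m = begin
  - s * binom (+ suc m - 1ℤ - (1ℤ + x)) (suc m)
    ≡⟨ cong (λ z → - s * binom z (suc m)) (shift-in (+ m) x) ⟩
  - s * binom y (suc m)
    ≡⟨ regroup s (binom y (suc m)) (binom y m) ⟩
  - s * (binom y (suc m) + binom y m) + s * binom y m
    ≡⟨ cong (λ z → - s * z + s * binom y m) (binom-pascal y m) ⟨
  - s * binom (1ℤ + y) (suc m) + s * binom y m
    ≡⟨ cong (λ z → - s * binom z (suc m) + s * binom y m) (shift-out (+ m) x) ⟩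
  - s * binom (+ suc m - 1ℤ - x) (suc m) + s * binom y m
    ∎
  where
  open ≡-Reasoning
  s y : ℤ
  s = sgn m
  y = + m - 1ℤ - x
  shift-in : ∀ m x → 1ℤ + m - 1ℤ - (1ℤ + x) ≡ m - 1ℤ - x
  shift-in = solve-∀
  shift-out : ∀ m x → 1ℤ + (m - 1ℤ - x) ≡ 1ℤ + m - 1ℤ - x
  shift-out = solve-∀
  regroup : ∀ s u v → - s * u ≡ - s * (u + v) + s * v
  regroup = solve-∀

-- Congruence modulo 0 is equality, so uniqueness of Pascal families gives an exact identity.
binom-reflect : ∀ x m → binom x m ≡ reflectedBinom x m
binom-reflect x m = ℤP.i-j≡0⇒i≡j _ _ (0∣⇒≡0 (divides-difference
  (pascal-unique binom reflectedBinom binom-isPascal (λ x k → ≡⇒≈ (reflectedBinom-pascal x k))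
                 column row m x)))
  where
  open Congruence 0
  open ≈-Reasoning
  open PascalFamilies 0
  column : ∀ x → binom x 0 ≈ reflectedBinom x 0
  column x = ≡⇒≈ (trans (binom[x,0]≡1 x) (sym (binom[x,0]≡1 (-1ℤ - x))))
  k-1-0≡k : ∀ k → 1ℤ + k - 1ℤ - 0ℤ ≡ k
  k-1-0≡k = solve-∀
  row : ∀ k → binom 0ℤ (suc k) ≈ reflectedBinom 0ℤ (suc k)
  row k = begin
    binom 0ℤ (suc k)                          ≡⟨ binom[a,k]≡0 {0} {suc k} (s≤s z≤n) ⟩
    0ℤ                                        ≡⟨ ℤP.*-zeroʳ (- sgn k) ⟨
    - sgn k * 0ℤ                              ≡⟨ cong (- sgn k *_) (binom[a,k]≡0 (ℕP.n<1+n k)) ⟨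
    - sgn k * binom (+ k) (suc k)             ≡⟨ cong (λ z → - sgn k * binom z (suc k)) (k-1-0≡k (+ k)) ⟨
    reflectedBinom 0ℤ (suc k)                 ∎

-- Lucas' theorem for generalized binomial coefficients

binom-absorb : ∀ n i → binom (+ suc n) (suc i) * + suc i ≡ + suc n * binom (+ n) i
binom-absorb n i = ℤP.*-cancelʳ-≡ _ _ (+ (i !)) {{i ℕP.!≢0}} (begin
  binom (+ suc n) (suc i) * + suc i * + (i !)   ≡⟨ ℤP.*-assoc (binom (+ suc n) (suc i)) (+ suc i) (+ (i !)) ⟩
  binom (+ suc n) (suc i) * (+ suc i * + (i !)) ≡⟨ cong (binom (+ suc n) (suc i) *_) (ℤP.pos-* (suc i) (i !)) ⟨
  binom (+ suc n) (suc i) * + (suc i !)         ≡⟨ falling≡binom*m! (+ suc n) (suc i) ⟨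
  falling (+ suc n) (suc i)                     ≡⟨ falling-suc (+ n) i ⟩
  + suc n * falling (+ n) i                     ≡⟨ cong (+ suc n *_) (falling≡binom*m! (+ n) i) ⟩
  + suc n * (binom (+ n) i * + (i !))           ≡⟨ ℤP.*-assoc (+ suc n) (binom (+ n) i) (+ (i !)) ⟨
  + suc n * binom (+ n) i * + (i !)             ∎)
  where open ≡-Reasoning

prime∣binom : ∀ {p j} → Prime p → 0 < j → j < p → + p ∣ binom (+ p) j
prime∣binom {zero}  p-prime _ _ = ⊥-elim (¬prime[0] p-prime)
prime∣binom {suc n} {suc i} p-prime _ j<p
  with euclidsLemma ∣ binom (+ suc n) (suc i) ∣ (suc i) p-prime p∣binom*j
  where
  p∣binom*j : suc n ℕ∣.∣ ∣ binom (+ suc n) (suc i) ∣ ℕ.* suc i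
  p∣binom*j = subst (suc n ℕ∣.∣_)
    (trans (cong ∣_∣ (sym (binom-absorb n i))) (ℤP.abs-* (binom (+ suc n) (suc i)) (+ suc i)))
    (subst (suc n ℕ∣.∣_) (sym (ℤP.abs-* (+ suc n) (binom (+ n) i))) (ℕ∣.m∣m*n ∣ binom (+ n) i ∣))
... | inj₁ p∣binom = ∣ᵤ⇒∣ p∣binom
... | inj₂ p∣j     = ⊥-elim (ℕP.<⇒≱ j<p (ℕ∣.∣⇒≤ p∣j))

-- The coefficient of t^k in t^n (1 + t)^x.
shiftedBinom : ℕ → ℤ → ℕ → ℤ
shiftedBinom zero    x k       = binom x k
shiftedBinom (suc n) x zero    = 0ℤ
shiftedBinom (suc n) x (suc k) = shiftedBinom n x k

shiftedBinom-pascal : ∀ n x k →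
  shiftedBinom n (1ℤ + x) (suc k) ≡ shiftedBinom n x (suc k) + shiftedBinom n x k
shiftedBinom-pascal zero          x k       = binom-pascal x k
shiftedBinom-pascal (suc zero)    x zero    = trans (binom[x,0]≡1 (1ℤ + x)) (sym (binom[x,0]≡1 x))
shiftedBinom-pascal (suc (suc n)) x zero    = refl
shiftedBinom-pascal (suc n)       x (suc k) = shiftedBinom-pascal n x k

shiftedBinom-below : ∀ {n k} x → k < n → shiftedBinom n x k ≡ 0ℤ
shiftedBinom-below {suc n} {zero}  x _         = refl
shiftedBinom-below {suc n} {suc k} x (s≤s k<n) = shiftedBinom-below x k<n

shiftedBinom-+ : ∀ n x t → shiftedBinom n x (n ℕ.+ t) ≡ binom x t
shiftedBinom-+ zero    x t = refl
shiftedBinom-+ (suc n) x t = shiftedBinom-+ n x t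

shiftedBinom[n,0,k]≡0 : ∀ {n k} → n < k → shiftedBinom n 0ℤ k ≡ 0ℤ
shiftedBinom[n,0,k]≡0 {zero}  {k}     n<k       = binom[a,k]≡0 {0} {k} n<k
shiftedBinom[n,0,k]≡0 {suc n} {suc k} (s≤s n<k) = shiftedBinom[n,0,k]≡0 n<k

module Lucas {p : ℕ} (p-prime : Prime p) where
  open Congruence p
  open ≈-Reasoning
  open PascalFamilies p

  private
    0<p : 0 < p
    0<p = ℕ.>-nonZero⁻¹ p {{prime⇒nonZero p-prime}}

  -- The coefficientwise form of (1 + t)^(x + p) ≡ (1 + t)^x (1 + t^p).
  binom-+p : ∀ x k → binom (x + + p) k ≈ binom x k + shiftedBinom p x k
  binom-+p x k = pascal-unique (λ x k → binom (x + + p) k) (λ x k → binom x k + shiftedBinom p x k)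
    (Pascal-translate (+ p) binom binom-isPascal)
    (Pascal-+ binom (shiftedBinom p) binom-isPascal (λ x k → ≡⇒≈ (shiftedBinom-pascal p x k)))
    column row k x
    where
    column : ∀ x → binom (x + + p) 0 ≈ binom x 0 + shiftedBinom p x 0
    column x = begin
      binom (x + + p) 0               ≡⟨ binom[x,0]≡1 (x + + p) ⟩
      1ℤ                              ≡⟨ cong₂ _+_ (binom[x,0]≡1 x) (shiftedBinom-below x 0<p) ⟨
      binom x 0 + shiftedBinom p x 0  ∎
    row : ∀ k → binom (+ p) (suc k) ≈ binom 0ℤ (suc k) + shiftedBinom p 0ℤ (suc k)
    row k rewrite binom[a,k]≡0 {0} {suc k} (s≤s z≤n) with ℕP.<-cmp (suc k) p
    ... | tri< k<p _ _ rewrite shiftedBinom-below 0ℤ k<p = ∣⇒≈0 (prime∣binom p-prime (s≤s z≤n) k<p)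
    ... | tri≈ _ refl _ = begin
      binom (+ p) p                 ≡⟨ binom[n,n]≡1 p ⟩
      1ℤ                            ≡⟨ binom[x,0]≡1 0ℤ ⟨
      binom 0ℤ 0                    ≡⟨ shiftedBinom-+ p 0ℤ 0 ⟨
      shiftedBinom p 0ℤ (p ℕ.+ 0)   ≡⟨ cong (shiftedBinom p 0ℤ) (ℕP.+-identityʳ p) ⟩
      shiftedBinom p 0ℤ p           ≡⟨ ℤP.+-identityˡ (shiftedBinom p 0ℤ p) ⟨
      0ℤ + shiftedBinom p 0ℤ p      ∎
    ... | tri> _ _ p<k rewrite shiftedBinom[n,0,k]≡0 p<k | binom[a,k]≡0 p<k = ≈-refl

  module _ {x₀ n₀ : ℕ} (x₀<p : x₀ < p) (n₀<p : n₀ < p) where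

    private
      X : ℤ → ℤ
      X y = + x₀ + y * + p
      N : ℕ → ℕ
      N m = n₀ ℕ.+ m ℕ.* p
      F : ℤ → ℕ → ℤ
      F y m = binom (X y) (N m)
      b : ℤ
      b = binom (+ x₀) n₀

      X-suc : ∀ y → X (1ℤ + y) ≡ X y + + p
      X-suc y = regroup (+ x₀) y (+ p)
        where regroup : ∀ x y p → x + (1ℤ + y) * p ≡ x + y * p + p
              regroup = solve-∀
      N-suc : ∀ m → N (suc m) ≡ p ℕ.+ N m
      N-suc m = regroup n₀ p (m ℕ.* p)
        where regroup : ∀ n p q → n ℕ.+ (p ℕ.+ q) ≡ p ℕ.+ (n ℕ.+ q)
              regroup = ℕ-Solver.solve-∀
      N0≡n₀ : N 0 ≡ n₀
      N0≡n₀ = ℕP.+-identityʳ n₀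

      F-suc : ∀ y m → F (1ℤ + y) m ≈ F y m + shiftedBinom p (X y) (N m)
      F-suc y m rewrite X-suc y = binom-+p (X y) (N m)

      F-isPascal : Pascal F
      F-isPascal y m = begin
        F (1ℤ + y) (suc m)
          ≈⟨ F-suc y (suc m) ⟩
        F y (suc m) + shiftedBinom p (X y) (N (suc m))
          ≡⟨ cong (λ k → F y (suc m) + shiftedBinom p (X y) k) (N-suc m) ⟩
        F y (suc m) + shiftedBinom p (X y) (p ℕ.+ N m)
          ≡⟨ cong (λ z → F y (suc m) + z) (shiftedBinom-+ p (X y) (N m)) ⟩
        F y (suc m) + F y m
          ∎

      F[1+y,0]≈F[y,0] : ∀ y → F (1ℤ + y) 0 ≈ F y 0
      F[1+y,0]≈F[y,0] y = begin
        F (1ℤ + y) 0                        ≈⟨ F-suc y 0 ⟩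
        F y 0 + shiftedBinom p (X y) (N 0)  ≡⟨ cong (λ z → F y 0 + z) (shiftedBinom-below (X y) N0<p) ⟩
        F y 0 + 0ℤ                          ≡⟨ ℤP.+-identityʳ (F y 0) ⟩
        F y 0                               ∎
        where N0<p : N 0 < p
              N0<p = subst (_< p) (sym N0≡n₀) n₀<p

      column : ∀ y → F y 0 ≈ b * binom y 0
      column y = begin
        F y 0          ≈⟨ invariant⇒constant (λ y → F y 0) F[1+y,0]≈F[y,0] y ⟩
        F 0ℤ 0         ≡⟨ cong₂ binom (ℤP.+-identityʳ (+ x₀)) N0≡n₀ ⟩
        b              ≡⟨ ℤP.*-identityʳ b ⟨
        b * 1ℤ         ≡⟨ cong (b *_) (binom[x,0]≡1 y) ⟨
        b * binom y 0  ∎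

      row : ∀ m → F 0ℤ (suc m) ≈ b * binom 0ℤ (suc m)
      row m = begin
        F 0ℤ (suc m)              ≡⟨ cong (λ x → binom x (N (suc m))) (ℤP.+-identityʳ (+ x₀)) ⟩
        binom (+ x₀) (N (suc m))  ≡⟨ binom[a,k]≡0 {x₀} {N (suc m)} x₀<N ⟩
        0ℤ                        ≡⟨ ℤP.*-zeroʳ b ⟨
        b * 0ℤ                    ≡⟨ cong (b *_) (binom[a,k]≡0 {0} {suc m} (s≤s z≤n)) ⟨
        b * binom 0ℤ (suc m)      ∎
        where x₀<N : x₀ < N (suc m)
              x₀<N = subst (x₀ <_) (sym (N-suc m)) (ℕP.<-≤-trans x₀<p (ℕP.m≤m+n p (N m)))

    binom-lucas : ∀ y m → binom (+ x₀ + y * + p) (n₀ ℕ.+ m ℕ.* p) ≈ binom (+ x₀) n₀ * binom y m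
    binom-lucas y m =
      pascal-unique F (λ y m → b * binom y m) F-isPascal (Pascal-*ˡ b binom binom-isPascal) column row m y

sgn-+ : ∀ a b → sgn (a ℕ.+ b) ≡ sgn a * sgn b
sgn-+ zero    b = sym (ℤP.*-identityˡ (sgn b))
sgn-+ (suc a) b = trans (cong -_ (sgn-+ a b)) (ℤP.neg-distribˡ-* (sgn a) (sgn b))

sgn*sgn≡1 : ∀ a → sgn a * sgn a ≡ 1ℤ
sgn*sgn≡1 zero    = refl
sgn*sgn≡1 (suc a) = trans (neg*neg (sgn a)) (sgn*sgn≡1 a)
  where neg*neg : ∀ s → - s * - s ≡ s * s
        neg*neg = solve-∀

sgn[m∸j]*sgn[m]≡sgn[j] : ∀ {m j} → j ≤ m → sgn (m ∸ j) * sgn m ≡ sgn j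
sgn[m∸j]*sgn[m]≡sgn[j] {m} {j} j≤m = begin
  s * sgn m                ≡⟨ cong (λ n → s * sgn n) (ℕP.m∸n+n≡m j≤m) ⟨
  s * sgn (m ∸ j ℕ.+ j)    ≡⟨ cong (s *_) (sgn-+ (m ∸ j) j) ⟩
  s * (s * sgn j)          ≡⟨ ℤP.*-assoc s s (sgn j) ⟨
  s * s * sgn j            ≡⟨ cong (_* sgn j) (sgn*sgn≡1 (m ∸ j)) ⟩
  1ℤ * sgn j               ≡⟨ ℤP.*-identityˡ (sgn j) ⟩
  sgn j                    ∎
  where
  open ≡-Reasoning
  s : ℤ
  s = sgn (m ∸ j)

sgn≡-1⊎2∣ : ∀ n → sgn n ≡ -1ℤ ⊎ 2 ℕ∣.∣ n
sgn≡-1⊎2∣ zero          = inj₂ (2 ℕ∣.∣0)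
sgn≡-1⊎2∣ (suc zero)    = inj₁ refl
sgn≡-1⊎2∣ (suc (suc n)) with sgn≡-1⊎2∣ n
... | inj₁ sgn≡-1 = inj₁ (trans (ℤP.neg-involutive (sgn n)) sgn≡-1)
... | inj₂ 2∣n    = inj₂ (ℕ∣.∣m∣n⇒∣m+n (ℕ∣.∣-refl {2}) 2∣n)

-- The digit products unfold only at a successor modulus, and p ≥ 2 makes the digits shrink.
module Digits (q : ℕ) where

  p : ℕ
  p = suc (suc q)

  /p-decreasing : ∀ {a} → ¬ a < p → a / p < a
  /p-decreasing {zero}  a≮p = ⊥-elim (a≮p (s≤s z≤n))
  /p-decreasing {suc a} _   = ℕD.m/n<m (suc a) p (s≤s (s≤s z≤n))

  private
    shrink : ∀ {a b h} → a < b → b ≤ suc h → a ≤ h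
    shrink a<b b≤1+h = ℕP.≤-pred (ℕP.<-≤-trans a<b b≤1+h)

  digitProd-fuel-irrelevant : ∀ A {f g n} → n ≤ f → n ≤ g →
                              digitProd-fuel f p A n ≡ digitProd-fuel g p A n
  digitProd-fuel-irrelevant A {zero}  {zero}  z≤n z≤n = refl
  digitProd-fuel-irrelevant A {zero}  {suc g} z≤n _   = refl
  digitProd-fuel-irrelevant A {suc f} {zero}  _   z≤n = refl
  digitProd-fuel-irrelevant A {suc f} {suc g} {n} n≤f n≤g with n ℕ.<? p
  ... | yes _   = refl
  ... | no  n≮p = cong (A (n % p) *_)
    (digitProd-fuel-irrelevant A (shrink (/p-decreasing n≮p) n≤f) (shrink (/p-decreasing n≮p) n≤g))

  digitProd₂-fuel-irrelevant : ∀ B {f g n k} → n ℕ.+ k ≤ f → n ℕ.+ k ≤ g →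
                               digitProd₂-fuel f p B n k ≡ digitProd₂-fuel g p B n k
  digitProd₂-fuel-irrelevant B {zero}  {zero}  {zero} {zero} _ _ = refl
  digitProd₂-fuel-irrelevant B {zero}  {suc g} {zero} {zero} _ _ = refl
  digitProd₂-fuel-irrelevant B {suc f} {zero}  {zero} {zero} _ _ = refl
  digitProd₂-fuel-irrelevant B {suc f} {suc g} {n} {k} n+k≤f n+k≤g with n ℕ.<? p | k ℕ.<? p
  ... | yes _   | yes _   = refl
  ... | yes _   | no  k≮p = cong (B (n % p) (k % p) *_) (digitProd₂-fuel-irrelevant B
    (shrink (ℕP.+-mono-≤-< (ℕD.m/n≤m n p) (/p-decreasing k≮p)) n+k≤f)
    (shrink (ℕP.+-mono-≤-< (ℕD.m/n≤m n p) (/p-decreasing k≮p)) n+k≤g))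
  ... | no  n≮p | _       = cong (B (n % p) (k % p) *_) (digitProd₂-fuel-irrelevant B
    (shrink (ℕP.+-mono-<-≤ (/p-decreasing n≮p) (ℕD.m/n≤m k p)) n+k≤f)
    (shrink (ℕP.+-mono-<-≤ (/p-decreasing n≮p) (ℕD.m/n≤m k p)) n+k≤g))

  digitProd-small : ∀ A {n} → n < p → digitProd p A n ≡ A n
  digitProd-small A {zero}  _   = refl
  digitProd-small A {suc n} n<p with suc n ℕ.<? p
  ... | yes _   = refl
  ... | no  n≮p = ⊥-elim (n≮p n<p)

  digitProd-step : ∀ A {n} → p ≤ n → digitProd p A n ≡ A (n % p) * digitProd p A (n / p)
  digitProd-step A {suc n} p≤n with suc n ℕ.<? p
  ... | yes n<p = ⊥-elim (ℕP.<⇒≱ n<p p≤n)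
  ... | no  n≮p = cong (A (suc n % p) *_)
    (digitProd-fuel-irrelevant A (ℕP.≤-pred (/p-decreasing n≮p)) ℕP.≤-refl)

  digitProd₂-step : ∀ B {n} k → p ≤ n →
                    digitProd₂ p B n k ≡ B (n % p) (k % p) * digitProd₂ p B (n / p) (k / p)
  digitProd₂-step B {suc n} k p≤n with suc n ℕ.<? p | k ℕ.<? p
  ... | yes n<p | _ = ⊥-elim (ℕP.<⇒≱ n<p p≤n)
  ... | no  n≮p | _ = cong (B (suc n % p) (k % p) *_) (digitProd₂-fuel-irrelevant B
    (ℕP.≤-pred (ℕP.+-mono-<-≤ (/p-decreasing n≮p) (ℕD.m/n≤m k p))) ℕP.≤-refl)

  [r+j*p]%p≡r : ∀ {r} j → r < p → (r ℕ.+ j ℕ.* p) % p ≡ r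
  [r+j*p]%p≡r {r} j r<p = trans (ℕD.[m+kn]%n≡m%n r j p) (ℕD.m<n⇒m%n≡m r<p)

  [r+j*p]/p≡j : ∀ {r} j → r < p → (r ℕ.+ j ℕ.* p) / p ≡ j
  [r+j*p]/p≡j {r} j r<p =
    trans (ℕD.+-distrib-/-∣ʳ r (ℕ∣.n∣m*n j)) (cong₂ ℕ._+_ (ℕD.m<n⇒m/n≡0 r<p) (ℕD.m*n/n≡m j p))

module LucasCongruences (q : ℕ) (p-prime : Prime (suc (suc q))) (B : ℕ → ℕ → ℤ) (B-lucas : DoubleLucas B)
            (B-symmetric : ∀ n k → k ≤ n → B n k ≡ B n (n ∸ k)) where

  open Digits q
  open Congruence p
  open Lucas p-prime

  sgn[p]≈-1 : sgn p ≈ -1ℤ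
  sgn[p]≈-1 with sgn≡-1⊎2∣ p
  ... | inj₁ sgn≡-1 = ≡⇒≈ sgn≡-1
  ... | inj₂ 2∣p with prime⇒irreducible p-prime 2∣p
  ...   | inj₂ refl = mk≈ ℤ∣.∣-refl

  sgn[k+j*p]≈sgn[k]*sgn[j] : ∀ k j → sgn (k ℕ.+ j ℕ.* p) ≈ sgn k * sgn j
  sgn[k+j*p]≈sgn[k]*sgn[j] k j = begin
    sgn (k ℕ.+ j ℕ.* p)   ≡⟨ sgn-+ k (j ℕ.* p) ⟩
    sgn k * sgn (j ℕ.* p) ≈⟨ *-congˡ (sgn k) (sgn[j*p]≈sgn[j] j) ⟩
    sgn k * sgn j         ∎
    where
    open ≈-Reasoning
    sgn[j*p]≈sgn[j] : ∀ j → sgn (j ℕ.* p) ≈ sgn j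
    sgn[j*p]≈sgn[j] zero    = ≈-refl
    sgn[j*p]≈sgn[j] (suc j) = begin
      sgn (p ℕ.+ j ℕ.* p)   ≡⟨ sgn-+ p (j ℕ.* p) ⟩
      sgn p * sgn (j ℕ.* p) ≈⟨ *-cong sgn[p]≈-1 (sgn[j*p]≈sgn[j] j) ⟩
      -1ℤ * sgn j           ≡⟨ ℤP.-1*i≡-i (sgn j) ⟩
      sgn (suc j)           ∎

  B-digits : ∀ {n₀ k₀} m j → n₀ < p → k₀ < p → 0 < m →
             B (n₀ ℕ.+ m ℕ.* p) (k₀ ℕ.+ j ℕ.* p) ≈ B n₀ k₀ * B m j
  B-digits {n₀} {k₀} m@(suc m-1) j n₀<p k₀<p _ = begin
    B n k
      ≈⟨ B≈digitProd₂ n k ⟩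
    digitProd₂ p B n k
      ≡⟨ digitProd₂-step B k p≤n ⟩
    B (n % p) (k % p) * digitProd₂ p B (n / p) (k / p)
      ≡⟨ cong₂ (λ a b → B a b * digitProd₂ p B (n / p) (k / p)) ([r+j*p]%p≡r m n₀<p) ([r+j*p]%p≡r j k₀<p) ⟩
    B n₀ k₀ * digitProd₂ p B (n / p) (k / p)
      ≡⟨ cong₂ (λ a b → B n₀ k₀ * digitProd₂ p B a b) ([r+j*p]/p≡j m n₀<p) ([r+j*p]/p≡j j k₀<p) ⟩
    B n₀ k₀ * digitProd₂ p B m j
      ≈⟨ *-congˡ (B n₀ k₀) (B≈digitProd₂ m j) ⟨
    B n₀ k₀ * B m j
      ∎
    where
    open ≈-Reasoning
    n k : ℕ
    n = n₀ ℕ.+ m ℕ.* p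
    k = k₀ ℕ.+ j ℕ.* p
    B≈digitProd₂ : ∀ n k → B n k ≈ digitProd₂ p B n k
    B≈digitProd₂ n k = mk≈ (∣ᵤ⇒∣ (proj₂ B-lucas p p-prime n k))
    p≤n : p ≤ n
    p≤n = ℕP.≤-trans (ℕP.m≤m+n p (m-1 ℕ.* p)) (ℕP.m≤n+m (m ℕ.* p) n₀)

  upper : ℕ → ℕ → ℤ
  upper n k = + (2 ℕ.* n) - + (3 ℕ.* k)

  term : ℕ → ℕ → ℤ
  term n k = sgn k * B n k * binom (upper n k) n

  A : ℕ → ℤ
  A = Aseq B

  carriedTerm : ℤ → ℕ → ℕ → ℤ
  carriedTerm c m j = sgn j * B m j * binom (upper m j + c) m

  term-vanishes : ∀ {n k} → n < k → term n k ≡ 0ℤ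
  term-vanishes {n} {k} n<k rewrite proj₁ B-lucas n k n<k =
    trans (cong (_* b) (ℤP.*-zeroʳ (sgn k))) (ℤP.*-zeroˡ b)
    where b : ℤ
          b = binom (upper n k) n

  carriedTerm-0 : ∀ m j → carriedTerm 0ℤ m j ≡ term m j
  carriedTerm-0 m j = cong (λ x → sgn j * B m j * binom x m) (ℤP.+-identityʳ _)

  carriedSum-[-1] : ∀ m → sum< (suc m) (carriedTerm -1ℤ m) ≡ sum< (suc m) (term m)
  carriedSum-[-1] m = trans (sum<-reverse m (carriedTerm -1ℤ m))
                            (sum<-cong (suc m) (λ j j<1+m → reflected (ℕP.≤-pred j<1+m)))
    where
    open ≡-Reasoning
    reflected : ∀ {j} → j ≤ m → carriedTerm -1ℤ m (m ∸ j) ≡ term m j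
    reflected {j} j≤m = begin
      s * B m (m ∸ j) * binom x m             ≡⟨ cong (λ b → s * b * binom x m) (B-symmetric m j j≤m) ⟨
      s * B m j * binom x m                   ≡⟨ cong (s * B m j *_) (binom-reflect x m) ⟩
      s * B m j * (sgn m * binom (+ m - 1ℤ - x) m)
                                              ≡⟨ cong (λ y → s * B m j * (sgn m * binom y m)) m-1-x≡2m-3j ⟩
      s * B m j * (sgn m * binom y m)         ≡⟨ regroup s (B m j) (sgn m) (binom y m) ⟩
      s * sgn m * B m j * binom y m           ≡⟨ cong (λ t → t * B m j * binom y m) (sgn[m∸j]*sgn[m]≡sgn[j] j≤m) ⟩
      sgn j * B m j * binom y m               ∎
      where
      s x y : ℤ
      s = sgn (m ∸ j)
      x = upper m (m ∸ j) + -1ℤ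
      y = upper m j
      regroup : ∀ s b t c → s * b * (t * c) ≡ s * t * b * c
      regroup = solve-∀
      reflect-arg : ∀ m j → m - 1ℤ - (+ 2 * m - + 3 * (m - j) + -1ℤ) ≡ + 2 * m - + 3 * j
      reflect-arg = solve-∀
      m-1-x≡2m-3j : + m - 1ℤ - x ≡ y
      m-1-x≡2m-3j = begin
        + m - 1ℤ - x
          ≡⟨ cong (λ z → + m - 1ℤ - (z - + (3 ℕ.* (m ∸ j)) + -1ℤ)) (ℤP.pos-* 2 m) ⟩
        + m - 1ℤ - (+ 2 * + m - + (3 ℕ.* (m ∸ j)) + -1ℤ)
          ≡⟨ cong (λ z → + m - 1ℤ - (+ 2 * + m - z + -1ℤ))
                  (trans (ℤP.pos-* 3 (m ∸ j)) (cong (+ 3 *_) (+[m∸n]≡+m-+n j≤m))) ⟩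
        + m - 1ℤ - (+ 2 * + m - + 3 * (+ m - + j) + -1ℤ)
          ≡⟨ reflect-arg (+ m) (+ j) ⟩
        + 2 * + m - + 3 * + j
          ≡⟨ cong₂ _-_ (ℤP.pos-* 2 m) (ℤP.pos-* 3 j) ⟨
        y ∎

  record Expansion (a : ℤ) : Set where
    field
      digit   : ℕ
      carry   : ℤ
      digit<p : digit < p
      expands : a ≡ + digit + carry * + p

  expansion : ∀ a → Expansion a
  expansion a = record
    { digit = a %ℕ p ; carry = a /ℕ p ; digit<p = n%ℕd<d a p ; expands = a≡a%ℕn+[a/ℕn]*n a p }

  -- For k₀ ≤ n₀ < p one has -n₀ ≤ 2n₀ - 3k₀ ≤ 2n₀, so the carry is 0, -1 or 1,
  -- and a carry 1 leaves a digit below n₀.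
  SmallCarry : ∀ {a} → ℕ → Expansion a → Set
  SmallCarry n₀ e = carry ≡ 0ℤ ⊎ carry ≡ -1ℤ ⊎ carry ≡ 1ℤ × digit < n₀
    where open Expansion e

  SmallCarryExpansion : ℕ → ℕ → Set
  SmallCarryExpansion n₀ k₀ = Σ (Expansion (upper n₀ k₀)) (SmallCarry n₀)

  noCarry : ∀ {n₀ k₀} → 3 ℕ.* k₀ ≤ 2 ℕ.* n₀ → 2 ℕ.* n₀ ∸ 3 ℕ.* k₀ < p → SmallCarryExpansion n₀ k₀
  noCarry {n₀} {k₀} 3k₀≤2n₀ t<p = record
    { digit = 2 ℕ.* n₀ ∸ 3 ℕ.* k₀ ; carry = 0ℤ ; digit<p = t<p
    ; expands = trans (sym (+[m∸n]≡+m-+n 3k₀≤2n₀)) (sym (ℤP.+-identityʳ (+ (2 ℕ.* n₀ ∸ 3 ℕ.* k₀)))) }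
    , inj₁ refl

  carryUp : ∀ {n₀ k₀} → 3 ℕ.* k₀ ≤ 2 ℕ.* n₀ → p ≤ 2 ℕ.* n₀ ∸ 3 ℕ.* k₀ → n₀ < p →
            SmallCarryExpansion n₀ k₀
  carryUp {n₀} {k₀} 3k₀≤2n₀ p≤t n₀<p = record
    { digit = t ∸ p ; carry = 1ℤ ; digit<p = ℕP.<-trans digit<n₀ n₀<p
    ; expands = begin
        upper n₀ k₀           ≡⟨ +[m∸n]≡+m-+n 3k₀≤2n₀ ⟨
        + t                   ≡⟨ cong +_ (ℕP.m∸n+n≡m p≤t) ⟨
        + (t ∸ p) + + p       ≡⟨ cong (λ z → + (t ∸ p) + z) (ℤP.*-identityˡ (+ p)) ⟨
        + (t ∸ p) + 1ℤ * + p  ∎ }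
    , inj₂ (inj₂ (refl , digit<n₀))
    where
    open ≡-Reasoning
    t : ℕ
    t = 2 ℕ.* n₀ ∸ 3 ℕ.* k₀
    t<p+n₀ : t < p ℕ.+ n₀
    t<p+n₀ = ℕP.≤-<-trans (ℕP.m∸n≤m (2 ℕ.* n₀) (3 ℕ.* k₀))
               (subst (λ z → n₀ ℕ.+ z < p ℕ.+ n₀) (sym (ℕP.+-identityʳ n₀)) (ℕP.+-monoˡ-< n₀ n₀<p))
    digit<n₀ : t ∸ p < n₀
    digit<n₀ = subst (t ∸ p <_) (ℕP.m+n∸m≡n p n₀) (ℕP.∸-monoˡ-< t<p+n₀ p≤t)

  carryDown : ∀ {n₀ k₀} → 2 ℕ.* n₀ < 3 ℕ.* k₀ → k₀ ≤ n₀ → n₀ < p → SmallCarryExpansion n₀ k₀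
  carryDown {n₀} {k₀} 2n₀<3k₀ k₀≤n₀ n₀<p = record
    { digit = p ∸ u ; carry = -1ℤ ; digit<p = ℕP.∸-monoʳ-< (ℕP.m<n⇒0<n∸m 2n₀<3k₀) u≤p
    ; expands = begin
        upper n₀ k₀                 ≡⟨ ℤP.[+m]-[+n]≡m⊖n (2 ℕ.* n₀) (3 ℕ.* k₀) ⟩
        (2 ℕ.* n₀) ℤ.⊖ (3 ℕ.* k₀)   ≡⟨ ℤP.⊖-< 2n₀<3k₀ ⟩
        - + u                       ≡⟨ negate (+ p) (+ u) ⟩
        + p - + u - + p             ≡⟨ cong₂ _+_ (+[m∸n]≡+m-+n u≤p) (ℤP.-1*i≡-i (+ p)) ⟨
        + (p ∸ u) + -1ℤ * + p       ∎ }
    , inj₂ (inj₁ refl)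
    where
    open ≡-Reasoning
    negate : ∀ p u → - u ≡ p - u - p
    negate = solve-∀
    u : ℕ
    u = 3 ℕ.* k₀ ∸ 2 ℕ.* n₀
    3n≡2n+n : ∀ n → 3 ℕ.* n ≡ 2 ℕ.* n ℕ.+ n
    3n≡2n+n = ℕ-Solver.solve-∀
    u≤n₀ : u ≤ n₀
    u≤n₀ = ℕP.≤-trans (ℕP.∸-monoˡ-≤ (2 ℕ.* n₀) (ℕP.*-monoʳ-≤ 3 k₀≤n₀))
             (ℕP.≤-reflexive (trans (cong (_∸ 2 ℕ.* n₀) (3n≡2n+n n₀)) (ℕP.m+n∸m≡n (2 ℕ.* n₀) n₀)))
    u≤p : u ≤ p
    u≤p = ℕP.≤-trans u≤n₀ (ℕP.<⇒≤ n₀<p)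

  smallCarryExpansion : ∀ {n₀ k₀} → k₀ ≤ n₀ → n₀ < p → SmallCarryExpansion n₀ k₀
  smallCarryExpansion {n₀} {k₀} k₀≤n₀ n₀<p with 3 ℕ.* k₀ ℕ.≤? 2 ℕ.* n₀
  ... | no  3k₀≰2n₀ = carryDown {n₀} {k₀} (ℕP.≰⇒> 3k₀≰2n₀) k₀≤n₀ n₀<p
  ... | yes 3k₀≤2n₀ with 2 ℕ.* n₀ ∸ 3 ℕ.* k₀ ℕ.<? p
  ...   | yes t<p = noCarry {n₀} {k₀} 3k₀≤2n₀ t<p
  ...   | no  t≮p = carryUp {n₀} {k₀} 3k₀≤2n₀ (ℕP.≮⇒≥ t≮p) n₀<p

  pos-digits : ∀ a x y → + (a ℕ.* (x ℕ.+ y ℕ.* p)) ≡ + (a ℕ.* x) + + (a ℕ.* y) * + p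
  pos-digits a x y = begin
    + (a ℕ.* (x ℕ.+ y ℕ.* p))             ≡⟨ cong +_ (distrib a x y p) ⟩
    + (a ℕ.* x ℕ.+ a ℕ.* y ℕ.* p)         ≡⟨ ℤP.pos-+ (a ℕ.* x) (a ℕ.* y ℕ.* p) ⟩
    + (a ℕ.* x) + + (a ℕ.* y ℕ.* p)       ≡⟨ cong (λ z → + (a ℕ.* x) + z) (ℤP.pos-* (a ℕ.* y) p) ⟩
    + (a ℕ.* x) + + (a ℕ.* y) * + p       ∎
    where
    open ≡-Reasoning
    distrib : ∀ a x y p → a ℕ.* (x ℕ.+ y ℕ.* p) ≡ a ℕ.* x ℕ.+ a ℕ.* y ℕ.* p
    distrib = ℕ-Solver.solve-∀

  argument-digits : ∀ n₀ k₀ m j (e : Expansion (upper n₀ k₀)) →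
    let open Expansion e in
    upper (n₀ ℕ.+ m ℕ.* p) (k₀ ℕ.+ j ℕ.* p) ≡ + digit + (upper m j + carry) * + p
  argument-digits n₀ k₀ m j e = begin
    upper (n₀ ℕ.+ m ℕ.* p) (k₀ ℕ.+ j ℕ.* p)
      ≡⟨ cong₂ _-_ (pos-digits 2 n₀ m) (pos-digits 3 k₀ j) ⟩
    (+ (2 ℕ.* n₀) + + (2 ℕ.* m) * + p) - (+ (3 ℕ.* k₀) + + (3 ℕ.* j) * + p)
      ≡⟨ separate (+ (2 ℕ.* n₀)) (+ (3 ℕ.* k₀)) (+ (2 ℕ.* m)) (+ (3 ℕ.* j)) (+ p) ⟩
    upper n₀ k₀ + upper m j * + p
      ≡⟨ cong (_+ upper m j * + p) expands ⟩
    (+ digit + carry * + p) + upper m j * + p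
      ≡⟨ absorb (+ digit) carry (upper m j) (+ p) ⟩
    + digit + (upper m j + carry) * + p
      ∎
    where
    open ≡-Reasoning
    open Expansion e
    separate : ∀ n k m j p → (n + m * p) - (k + j * p) ≡ (n - k) + (m - j) * p
    separate = solve-∀
    absorb : ∀ d c y p → (d + c * p) + y * p ≡ d + (y + c) * p
    absorb = solve-∀

  term≈digitTerm : ∀ n₀ k₀ → n₀ < p → (e : Expansion (upper n₀ k₀)) →
                   term n₀ k₀ ≈ sgn k₀ * B n₀ k₀ * binom (+ Expansion.digit e) n₀
  term≈digitTerm n₀ k₀ n₀<p e = *-congˡ (sgn k₀ * B n₀ k₀) (begin
    binom (upper n₀ k₀) n₀                     ≡⟨ cong₂ binom (sym expands) (ℕP.+-identityʳ n₀) ⟨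
    binom (+ digit + carry * + p) (n₀ ℕ.+ 0)   ≈⟨ binom-lucas digit<p n₀<p carry 0 ⟩
    binom (+ digit) n₀ * binom carry 0         ≡⟨ cong (binom (+ digit) n₀ *_) (binom[x,0]≡1 carry) ⟩
    binom (+ digit) n₀ * 1ℤ                    ≡⟨ ℤP.*-identityʳ (binom (+ digit) n₀) ⟩
    binom (+ digit) n₀                         ∎)
    where
    open ≈-Reasoning
    open Expansion e

  term-digits : ∀ n₀ k₀ m j → n₀ < p → k₀ < p → 0 < m →
                (e : Expansion (upper n₀ k₀)) →
                term (n₀ ℕ.+ m ℕ.* p) (k₀ ℕ.+ j ℕ.* p) ≈ term n₀ k₀ * carriedTerm (Expansion.carry e) m j
  term-digits n₀ k₀ m j n₀<p k₀<p 0<m e = begin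
    sgn k * B n k * binom (upper n k) n
      ≈⟨ *-congʳ (binom (upper n k) n)
           (*-cong (sgn[k+j*p]≈sgn[k]*sgn[j] k₀ j) (B-digits m j n₀<p k₀<p 0<m)) ⟩
    sgn k₀ * sgn j * (B n₀ k₀ * B m j) * binom (upper n k) n
      ≡⟨ cong (λ x → sgn k₀ * sgn j * (B n₀ k₀ * B m j) * binom x n) (argument-digits n₀ k₀ m j e) ⟩
    sgn k₀ * sgn j * (B n₀ k₀ * B m j) * binom (+ digit + y * + p) n
      ≈⟨ *-congˡ (sgn k₀ * sgn j * (B n₀ k₀ * B m j)) (binom-lucas digit<p n₀<p y m) ⟩
    sgn k₀ * sgn j * (B n₀ k₀ * B m j) * (binom (+ digit) n₀ * binom y m)
      ≡⟨ regroup (sgn k₀) (sgn j) (B n₀ k₀) (B m j) (binom (+ digit) n₀) (binom y m) ⟩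
    digitTerm * carriedTerm carry m j
      ≈⟨ *-congʳ (carriedTerm carry m j) (term≈digitTerm n₀ k₀ n₀<p e) ⟨
    term n₀ k₀ * carriedTerm carry m j
      ∎
    where
    open ≈-Reasoning
    open Expansion e
    n k : ℕ
    n = n₀ ℕ.+ m ℕ.* p
    k = k₀ ℕ.+ j ℕ.* p
    y digitTerm : ℤ
    y = upper m j + carry
    digitTerm = sgn k₀ * B n₀ k₀ * binom (+ digit) n₀
    regroup : ∀ s t b c u v → s * t * (b * c) * (u * v) ≡ s * b * u * (t * c * v)
    regroup = solve-∀

  blockSum-factor : ∀ n₀ k₀ m → n₀ < p → k₀ < p → 0 < m →
                    (e : Expansion (upper n₀ k₀)) →
                    sum< (suc m) (λ j → term (n₀ ℕ.+ m ℕ.* p) (k₀ ℕ.+ j ℕ.* p))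
                      ≈ term n₀ k₀ * sum< (suc m) (carriedTerm (Expansion.carry e) m)
  blockSum-factor n₀ k₀ m n₀<p k₀<p 0<m e =
    ≈-trans (sum<-cong≈ (suc m) (λ j _ → term-digits n₀ k₀ m j n₀<p k₀<p 0<m e))
            (≡⇒≈ (sum<-*ˡ (suc m) (term n₀ k₀) (carriedTerm (Expansion.carry e) m)))

  smallCarry-irrelevant : ∀ n₀ k₀ m → n₀ < p → (e : Expansion (upper n₀ k₀)) →
                          SmallCarry n₀ e →
                          term n₀ k₀ * sum< (suc m) (carriedTerm (Expansion.carry e) m) ≈ term n₀ k₀ * A m
  smallCarry-irrelevant n₀ k₀ m n₀<p e small with Expansion.carry e | small
  ... | _ | inj₁ refl = ≡⇒≈ (cong (term n₀ k₀ *_)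
          (trans (sum<-cong (suc m) (λ j _ → carriedTerm-0 m j)) (sym (sumTo≡sum< m (term m)))))
  ... | _ | inj₂ (inj₁ refl) = ≡⇒≈ (cong (term n₀ k₀ *_)
          (trans (carriedSum-[-1] m) (sym (sumTo≡sum< m (term m)))))
  ... | _ | inj₂ (inj₂ (refl , digit<n₀)) = x≈0⇒x*y≈x*z term≈0
    where
    term≈0 : term n₀ k₀ ≈ 0ℤ
    term≈0 = ≈-trans (term≈digitTerm n₀ k₀ n₀<p e) (≡⇒≈
      (trans (cong (sgn k₀ * B n₀ k₀ *_) (binom[a,k]≡0 digit<n₀)) (ℤP.*-zeroʳ (sgn k₀ * B n₀ k₀))))

  blockSum : ∀ n₀ k₀ m → n₀ < p → k₀ < p → 0 < m →
             sum< (suc m) (λ j → term (n₀ ℕ.+ m ℕ.* p) (k₀ ℕ.+ j ℕ.* p)) ≈ term n₀ k₀ * A m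
  blockSum n₀ k₀ m n₀<p k₀<p 0<m with k₀ ℕ.≤? n₀
  ... | yes k₀≤n₀ = let (e , small) = smallCarryExpansion k₀≤n₀ n₀<p in
    ≈-trans (blockSum-factor n₀ k₀ m n₀<p k₀<p 0<m e) (smallCarry-irrelevant n₀ k₀ m n₀<p e small)
  ... | no  k₀≰n₀ = ≈-trans (blockSum-factor n₀ k₀ m n₀<p k₀<p 0<m (expansion (upper n₀ k₀)))
    (x≈0⇒x*y≈x*z (≡⇒≈ (term-vanishes (ℕP.≰⇒> k₀≰n₀))))

  A-digit-step : ∀ n₀ m → n₀ < p → 0 < m → A (n₀ ℕ.+ m ℕ.* p) ≈ A n₀ * A m
  A-digit-step n₀ m n₀<p 0<m = begin
    A n
      ≡⟨ sumTo≡sum< n (term n) ⟩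
    sum< (suc n) (term n)
      ≡⟨ sum<-pad (term n) n<[1+m]*p (λ _ → term-vanishes) ⟨
    sum< (suc m ℕ.* p) (term n)
      ≡⟨ sum<-blocks p (suc m) (term n) ⟩
    sum< p (λ k₀ → sum< (suc m) (λ j → term n (k₀ ℕ.+ j ℕ.* p)))
      ≈⟨ sum<-cong≈ p (λ k₀ k₀<p → blockSum n₀ k₀ m n₀<p k₀<p 0<m) ⟩
    sum< p (λ k₀ → term n₀ k₀ * A m)
      ≡⟨ sum<-*ʳ p (term n₀) (A m) ⟩
    sum< p (term n₀) * A m
      ≡⟨ cong (_* A m) (sum<-pad (term n₀) n₀<p (λ _ → term-vanishes)) ⟩
    sum< (suc n₀) (term n₀) * A m
      ≡⟨ cong (_* A m) (sumTo≡sum< n₀ (term n₀)) ⟨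
    A n₀ * A m
      ∎
    where
    open ≈-Reasoning
    n : ℕ
    n = n₀ ℕ.+ m ℕ.* p
    n<[1+m]*p : suc n ≤ suc m ℕ.* p
    n<[1+m]*p = ℕP.+-monoˡ-< (m ℕ.* p) n₀<p

  A-lucas : ∀ n → A n ≈ digitProd p A n
  A-lucas = <-rec (λ n → A n ≈ digitProd p A n) step
    where
    open ≈-Reasoning
    step : ∀ n → (∀ {m} → m < n → A m ≈ digitProd p A m) → A n ≈ digitProd p A n
    step n IH with n ℕ.<? p
    ... | yes n<p = ≡⇒≈ (sym (digitProd-small A n<p))
    ... | no  n≮p = begin
      A n                               ≡⟨ cong A (ℕD.m≡m%n+[m/n]*n n p) ⟩
      A (n % p ℕ.+ n / p ℕ.* p)         ≈⟨ A-digit-step (n % p) (n / p) (ℕD.m%n<n n p) (ℕD.m≥n⇒m/n>0 p≤n) ⟩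
      A (n % p) * A (n / p)             ≈⟨ *-congˡ (A (n % p)) (IH (/p-decreasing n≮p)) ⟩
      A (n % p) * digitProd p A (n / p) ≡⟨ digitProd-step A p≤n ⟨
      digitProd p A n                   ∎
      where
      p≤n : p ≤ n
      p≤n = ℕP.≮⇒≥ n≮p

theorem4p1 : (B : ℕ → ℕ → ℤ) → DoubleLucas B →
    (∀ n k → k ≤ n → B n k ≡ B n (n ∸ k)) →
    ∀ p → Prime p → ∀ n → Aseq B n ≡[mod p ] digitProd p (Aseq B) n
theorem4p1 B B-lucas B-symmetric zero          p-prime n = ⊥-elim (¬prime[0] p-prime)
theorem4p1 B B-lucas B-symmetric (suc zero)    p-prime n = ⊥-elim (¬prime[1] p-prime)
theorem4p1 B B-lucas B-symmetric (suc (suc q)) p-prime n =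
  ∣⇒∣ᵤ (divides-difference (A-lucas n))
  where
  open LucasCongruences q p-prime B B-lucas B-symmetric
  open Congruence (suc (suc q))
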